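{- Let $m,n\geq 3$ be integers and $D=\overrightarrow{C}_m[\overrightarrow{C}_n]$. For any harmonious coloring of $D$ with $k$ colors, \[k\geq \min\{\max\{f_n(x),g_n(x)\}: x\in\mathbb{N},\ x\geq 1\},\] where $f_n(x)=\lceil mn/x\rceil$ and $g_n(x)=x(n+1)+1$.
   Context: $\overrightarrow{C}_m$ is the directed cycle with vertex set $\mathbb{Z}_m$ and arcs $j\to j+1$. The lexicographic product $D[H]$ has vertex set $V(D)\times V(H)$, with an arc from $(u,a)$ to $(v,b)$ iff $uv\in A(D)$, or $u=v$ and $ab\in A(H)$. A coloring with $k$ colors is a surjection $V(D)\to[k]$ that is proper (each color class spans no arc); it is harmonious if for every ordered pair $(i,j)$ of distinct colors there is at most one arc from a vertex colored $i$ to a vertex colored $j$. -}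

module Defs where

open import Data.Nat using (ℕ; zero; suc; _+_; _*_; _⊔_; _≤_)
open import Data.Nat.DivMod using (_/_)
open import Data.Fin using (Fin; toℕ)
open import Data.Product using (_×_; _,_; ∃-syntax)
open import Data.Sum using (_⊎_)
open import Relation.Binary.PropositionalEquality using (_≡_; _≢_)

-- Arc relation of the directed cycle C_m on Z_m ≅ Fin m : j → j+1 (mod m)
CycArc : (m : ℕ) → Fin m → Fin m → Set
CycArc m i j = (toℕ j ≡ suc (toℕ i)) ⊎ ((suc (toℕ i) ≡ m) × (toℕ j ≡ 0))

LexArc : (m n : ℕ) → (Fin m × Fin n) → (Fin m × Fin n) → Set
LexArc m n (u , a) (v , b) = CycArc m u v ⊎ ((u ≡ v) × CycArc n a b)

Surjective : {A B : Set} → (A → B) → Set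
Surjective {A} {B} c = (y : B) → ∃[ x ] c x ≡ y

IsColoring : {V : Set} → (Arc : V → V → Set) → (k : ℕ) → (V → Fin k) → Set
IsColoring {V} Arc k c = Surjective c × ((x y : V) → Arc x y → c x ≢ c y)

IsHarmonious : {V : Set} → (Arc : V → V → Set) → (k : ℕ) → (V → Fin k) → Set
IsHarmonious {V} Arc k c =
  IsColoring Arc k c ×
  ((x y x' y' : V) → Arc x y → Arc x' y' → c x ≢ c y →
     c x ≡ c x' → c y ≡ c y' → (x ≡ x') × (y ≡ y'))

-- ⌈ a / x ⌉ for x ≥ 1 (value at x = 0 is irrelevant, set to 0)
ceilDiv : ℕ → ℕ → ℕ
ceilDiv a zero = 0
ceilDiv a (suc x) = (a + x) / suc x

f : (m n x : ℕ) → ℕ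
f m n x = ceilDiv (m * n) x

g : (n x : ℕ) → ℕ
g n x = x * (n + 1) + 1

-- By pigeonhole some colour
-- class has x ≥ mn/k vertices, so f_n(x) ≤ k. Every vertex has n + 1 out-neighbours,
-- so the class sends x(n + 1) arcs into the other colours; harmony forces their
-- heads to carry pairwise distinct colours, all different from the class colour,
-- whence x(n + 1) + 1 ≤ k.
module Submission where

open import Defs
open import Data.Nat using (ℕ; zero; suc; _+_; _*_; _≤_; _<_; _⊔_; z≤n; s≤s; s≤s⁻¹; _≟_)
open import Data.Nat.Properties
open import Data.Nat.DivMod using (m<n*o⇒m/o<n)
open import Data.Fin as Fin using (Fin; toℕ; fromℕ<; punchOut)
open import Data.Fin.Properties
  using (toℕ-injective; toℕ-fromℕ<; toℕ<n; punchOut-injective; injective⇒≤; *↔×)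
open import Data.Product using (_×_; _,_; proj₁; proj₂; ∃-syntax)
open import Data.Sum using (inj₁; inj₂)
open import Data.List using (List; []; _∷_; length; filter; lookup; tabulate)
open import Data.List.Properties using (filter-all; length-tabulate)
open import Data.List.Membership.Propositional.Properties using (∈-lookup)
open import Data.List.Relation.Unary.All as All using (All)
open import Data.List.Relation.Unary.All.Properties using (all-filter)
  renaming (filter⁺ to All-filter⁺)
open import Data.List.Relation.Unary.AllPairs using (_∷_)
open import Data.List.Relation.Unary.Unique.Propositional using (Unique)
open import Data.List.Relation.Unary.Unique.Propositional.Properties using (tabulate⁺)
  renaming (filter⁺ to Unique-filter⁺)
open import Data.List.Relation.Binary.Sublist.Propositional.Properties using (filter-⊆; length-mono-≤)
  renaming (filter⁺ to ⊆-filter⁺)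
open import Function using (_∘_; _↣_; Injection)
open import Function.Definitions using (Injective)
open import Function.Properties.Inverse using (↔⇒↣)
open import Level using (0ℓ)
open import Relation.Nullary using (¬_; yes; no; contradiction)
open import Relation.Unary using (Pred; Decidable)
open import Relation.Unary.Properties using (∁?)
open import Relation.Binary.PropositionalEquality using (_≡_; _≢_; refl; sym; trans; cong; subst)

module _ {A : Set} {P : Pred A 0ℓ} (P? : Decidable P) where

  length-filter-∁ : (xs : List A) →
    length xs ≡ length (filter P? xs) + length (filter (∁? P?) xs)
  length-filter-∁ [] = refl
  length-filter-∁ (x ∷ xs) with P? x
  ... | yes _ = cong suc (length-filter-∁ xs)
  ... | no _ = trans (cong suc (length-filter-∁ xs)) (sym (+-suc _ _))

lookup-injective : {A : Set} {xs : List A} → Unique xs → Injective _≡_ _≡_ (lookup xs)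
lookup-injective {xs = _ ∷ _} _ {Fin.zero} {Fin.zero} _ = refl
lookup-injective {xs = _ ∷ _} (x∉ ∷ _) {Fin.zero} {Fin.suc j} eq =
  contradiction eq (All.lookup x∉ (∈-lookup j))
lookup-injective {xs = _ ∷ _} (x∉ ∷ _) {Fin.suc i} {Fin.zero} eq =
  contradiction (sym eq) (All.lookup x∉ (∈-lookup i))
lookup-injective {xs = _ ∷ _} (_ ∷ u) {Fin.suc i} {Fin.suc j} eq = cong Fin.suc (lookup-injective u eq)

module Pigeonhole {A : Set} (h : A → ℕ) where

  fibre : ℕ → List A → List A
  fibre j = filter (λ a → h a ≟ j)

  fibre-mono-filter : ∀ {Q : Pred A 0ℓ} (Q? : Decidable Q) j xs →
    length (fibre j (filter Q? xs)) ≤ length (fibre j xs)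
  fibre-mono-filter Q? j xs =
    length-mono-≤ (⊆-filter⁺ (λ a → h a ≟ j) (λ a → h a ≟ j) (λ { refl p → p }) (filter-⊆ Q? xs))

  pigeonhole : ∀ k xs → All (λ a → h a < suc k) xs →
    ∃[ j ] j < suc k × length xs ≤ suc k * length (fibre j xs)
  pigeonhole zero xs h<1 =
    0 , s≤s z≤n , ≤-reflexive (trans (cong length (sym (filter-all (λ a → h a ≟ 0) h≡0)))
                                     (sym (*-identityˡ _)))
    where h≡0 = All.map n<1⇒n≡0 h<1
  pigeonhole (suc k) xs h<2+k = choose (pigeonhole k below below<1+k)
    where
    top? = λ a → h a ≟ suc k
    below = filter (∁? top?) xs
    below<1+k : All (λ a → h a < suc k) below
    below<1+k = All.zipWith (λ (h<2+k , h≢1+k) → ≤∧≢⇒< (s≤s⁻¹ h<2+k) h≢1+k)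
                            (All-filter⁺ (∁? top?) h<2+k , all-filter (∁? top?) xs)
    split : ∀ j → length below ≤ suc k * length (fibre j below) →
            length xs ≤ length (fibre (suc k) xs) + suc k * length (fibre j xs)
    split j below≤ = begin
      length xs                               ≡⟨ length-filter-∁ top? xs ⟩
      length (fibre (suc k) xs) + length below
        ≤⟨ +-monoʳ-≤ (length (fibre (suc k) xs)) below≤ ⟩
      length (fibre (suc k) xs) + suc k * length (fibre j below)
        ≤⟨ +-monoʳ-≤ (length (fibre (suc k) xs))
                     (*-monoʳ-≤ (suc k) (fibre-mono-filter (∁? top?) j xs)) ⟩
      length (fibre (suc k) xs) + suc k * length (fibre j xs) ∎
      where open ≤-Reasoning
    choose : ∃[ j ] j < suc k × length below ≤ suc k * length (fibre j below) →
             ∃[ j ] j < suc (suc k) × length xs ≤ suc (suc k) * length (fibre j xs)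
    choose (j , j<1+k , below≤) with ≤-total (length (fibre (suc k) xs)) (length (fibre j xs))
    ... | inj₁ top≤j = j , m<n⇒m<1+n j<1+k ,
      ≤-trans (split j below≤) (+-monoˡ-≤ (suc k * length (fibre j xs)) top≤j)
    ... | inj₂ j≤top = suc k , ≤-refl ,
      ≤-trans (split j below≤) (+-monoʳ-≤ (length (fibre (suc k) xs)) (*-monoʳ-≤ (suc k) j≤top))

record ColourClass {V : Set} {k : ℕ} (c : V → Fin k) (x : ℕ) : Set where
  field
    colour : Fin k
    member : Fin x → V
    member-injective : Injective _≡_ _≡_ member
    member-colour : ∀ p → c (member p) ≡ colour

largeColourClass : ∀ {V : Set} {N k} → Fin N ↣ V → (c : V → Fin (suc k)) →
  ∃[ x ] N ≤ suc k * x × ColourClass c x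
largeColourClass {N = N} {k} ι c = classOf (pigeonhole k vertices (All.tabulate (λ _ → toℕ<n _)))
  where
  open Pigeonhole (toℕ ∘ c)
  vertices = tabulate (Injection.to ι)
  classOf : ∃[ j ] j < suc k × length vertices ≤ suc k * length (fibre j vertices) →
            ∃[ x ] N ≤ suc k * x × ColourClass c x
  classOf (j , j<1+k , N≤) =
    length (fibre j vertices) ,
    subst (_≤ suc k * length (fibre j vertices)) (length-tabulate (Injection.to ι)) N≤ ,
    record
      { colour = fromℕ< j<1+k
      ; member = lookup (fibre j vertices)
      ; member-injective = lookup-injective (Unique-filter⁺ _ (tabulate⁺ (Injection.injective ι)))
      ; member-colour = λ p → toℕ-injective (trans (All.lookup (all-filter _ vertices) (∈-lookup p))
                                                   (sym (toℕ-fromℕ< j<1+k)))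
      }

module _ {V : Set} {Arc : V → V → Set} {d : ℕ} (out : V → Fin d → V)
  (out-arc : ∀ v t → Arc v (out v t)) (out-injective : ∀ v → Injective _≡_ _≡_ (out v)) where

  harmonious-class-bound : ∀ {k x} {c : V → Fin k} → IsHarmonious Arc k c →
    ColourClass c x → x * d < k
  harmonious-class-bound {suc k} {x} {c} ((_ , proper) , harmonious) C =
    s≤s (injective⇒≤ (λ eq → Injection.injective (↔⇒↣ *↔×) (head-colour-injective eq)))
    where
    open ColourClass C
    head : Fin x × Fin d → V
    head (p , t) = out (member p) t
    colour≢ : ∀ e → colour ≢ c (head e)
    colour≢ (p , t) = proper _ _ (out-arc (member p) t) ∘ trans (member-colour p)
    head-colour : Fin x × Fin d → Fin k
    head-colour e = punchOut (colour≢ e)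
    head-colour-injective : Injective _≡_ _≡_ head-colour
    head-colour-injective {p , t} {p' , t'} eq
      with tails , heads ← harmonious _ _ _ _ (out-arc (member p) t) (out-arc (member p') t')
                             (proper _ _ (out-arc (member p) t))
                             (trans (member-colour p) (sym (member-colour p')))
                             (punchOut-injective (colour≢ (p , t)) (colour≢ (p' , t')) eq)
      with refl ← member-injective tails = cong (p ,_) (out-injective (member p) heads)

cycOut : ∀ {m} (u : Fin (suc m)) → ∃[ v ] CycArc (suc m) u v
cycOut {m} u with suc (toℕ u) ≟ suc m
... | yes last = Fin.zero , inj₂ (last , refl)
... | no ¬last = fromℕ< u+1<m , inj₁ (toℕ-fromℕ< u+1<m)
  where u+1<m = ≤∧≢⇒< (toℕ<n u) ¬last

cycArc-irreflexive : ∀ {m} (u : Fin (suc (suc m))) → ¬ CycArc (suc (suc m)) u u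
cycArc-irreflexive u (inj₁ u≡u+1) = 1+n≢n (sym u≡u+1)
cycArc-irreflexive u (inj₂ (u+1≡m , u≡0)) = 0≢1+n (trans (sym u≡0) (suc-injective u+1≡m))

-- Index 0 is the arc (u , a) → (u , a + 1) inside a copy of C_n; index 1 + b the arc to (u + 1 , b).
lexOut : ∀ {m n} → Fin (suc m) × Fin (suc n) → Fin (suc (suc n)) → Fin (suc m) × Fin (suc n)
lexOut (u , a) Fin.zero = u , proj₁ (cycOut a)
lexOut (u , a) (Fin.suc b) = proj₁ (cycOut u) , b

lexOut-arc : ∀ {m n} v t → LexArc (suc m) (suc n) v (lexOut v t)
lexOut-arc (u , a) Fin.zero = inj₂ (refl , proj₂ (cycOut a))
lexOut-arc (u , a) (Fin.suc b) = inj₁ (proj₂ (cycOut u))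

lexOut-injective : ∀ {m n} (v : Fin (suc (suc m)) × Fin (suc n)) → Injective _≡_ _≡_ (lexOut v)
lexOut-injective v {Fin.zero} {Fin.zero} _ = refl
lexOut-injective (u , _) {Fin.zero} {Fin.suc _} eq =
  contradiction (subst (CycArc _ u) (sym (cong proj₁ eq)) (proj₂ (cycOut u))) (cycArc-irreflexive u)
lexOut-injective (u , _) {Fin.suc _} {Fin.zero} eq =
  contradiction (subst (CycArc _ u) (cong proj₁ eq) (proj₂ (cycOut u))) (cycArc-irreflexive u)
lexOut-injective v {Fin.suc _} {Fin.suc _} eq = cong Fin.suc (cong proj₂ eq)

ceilDiv-≤ : ∀ N k x → N ≤ k * suc x → ceilDiv N (suc x) ≤ k
ceilDiv-≤ N k x N≤ = s≤s⁻¹ (m<n*o⇒m/o<n {N + x} {suc k} {suc x}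
  (s≤s (≤-trans (≤-reflexive (+-comm N x)) (+-monoʳ-≤ x N≤))))

g≡suc : ∀ n x → g n x ≡ suc (x * suc n)
g≡suc n x = trans (cong (λ d → x * d + 1) (+-comm n 1)) (+-comm _ 1)

theorem10 : (m n k : ℕ) → 3 ≤ m → 3 ≤ n →
    (c : Fin m × Fin n → Fin k) → IsHarmonious (LexArc m n) k c →
    ∃[ x ] (1 ≤ x × (f m n x ⊔ g n x) ≤ k)
theorem10 (suc (suc _)) (suc _) zero (s≤s (s≤s _)) (s≤s _) c _ with () ← c (Fin.zero , Fin.zero)
theorem10 m@(suc (suc _)) n@(suc _) (suc k') (s≤s (s≤s _)) (s≤s _) c harmonious
  with largeColourClass (↔⇒↣ *↔×) c
... | zero , mn≤0 , _ = contradiction (≤-trans mn≤0 (≤-reflexive (*-zeroʳ (suc k')))) λ ()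
... | x@(suc x') , mn≤kx , C =
  x , s≤s z≤n ,
  ⊔-lub (ceilDiv-≤ (m * n) (suc k') x' mn≤kx)
        (subst (_≤ suc k') (sym (g≡suc n x))
               (harmonious-class-bound lexOut lexOut-arc lexOut-injective harmonious C))
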